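{- Let $p$ be an odd prime, $\alpha,\beta\geq 1$ integers, and $\Gamma=\mathrm{Cay}(\mathbb{Z}_{p}\times\mathbb{Z}_{2^{\alpha}p^{\beta}},\Phi)$ with $\Phi=\varphi_p\times\varphi_{2^{\alpha}p^{\beta}}$. Then $\mathrm{diam}(\Gamma)=3$.
   Context: For $n\geq 1$, $\mathbb{Z}_n=\{0,\dots,n-1\}$ is the integers mod $n$ and $\varphi_n$ is the set of elements of $\mathbb{Z}_n$ coprime to $n$ ($\varphi_p=\mathbb{Z}_p\setminus\{0\}$). $\mathrm{Cay}(\mathbb{Z}_p\times\mathbb{Z}_m,\varphi_p\times\varphi_m)$ is the graph on $\mathbb{Z}_p\times\mathbb{Z}_m$ where $(u,v)\sim(u',v')$ iff $u-u'\in\varphi_p$ and $v-v'\in\varphi_m$. Diameter is the maximum distance between two vertices. -}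

module Defs where

open import Data.Nat using (ℕ; zero; suc; _+_; _*_; _^_; _≤_; _<_; NonZero)
open import Data.Nat.DivMod using (_%_)
open import Data.Nat.Coprimality using (Coprime)
open import Data.Fin using (Fin; toℕ)
open import Data.Product using (_×_; _,_; Σ; ∃; ∃-syntax)
open import Relation.Nullary using (¬_)

-- Difference (u - u') taken in ℤ_n, represented in {0,…,n-1}:
-- (u + n - u') mod n, computed without subtraction as ((n - u') + u) via toℕ.
-- We use: subMod n u u' = (u + (n ∸ u')) % n.
open import Data.Nat using (_∸_)

subMod : (n : ℕ) → .{{_ : NonZero n}} → Fin n → Fin n → ℕ
subMod n u u' = (toℕ u + (n ∸ toℕ u')) % n

inφ : (n : ℕ) → ℕ → Set
inφ n x = Coprime x n

Adj : (p m : ℕ) → .{{_ : NonZero p}} → .{{_ : NonZero m}} →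
      Fin p × Fin m → Fin p × Fin m → Set
Adj p m (u , v) (u' , v') = inφ p (subMod p u u') × inφ m (subMod m v v')

data Walk {V : Set} (E : V → V → Set) : V → V → ℕ → Set where
  here : ∀ {x} → Walk E x x zero
  step : ∀ {x y z k} → E x y → Walk E y z k → Walk E x z (suc k)

DistLe : {V : Set} (E : V → V → Set) → V → V → ℕ → Set
DistLe E x y d = ∃[ k ] (k ≤ d × Walk E x y k)

HasDiameter : (V : Set) (E : V → V → Set) → ℕ → Set
HasDiameter V E d =
  ((x y : V) → DistLe E x y d) ×
  (∃[ x ] ∃[ y ] (∀ k → k < d → ¬ Walk E x y k))

-- A walk of length k from y to x exists exactly when, in each coordinate, the difference
-- x - y is a sum of k units.  Modulo an odd prime p every residue is a sum of two units.
-- Modulo m with prime divisors 2 and p every unit is odd, so a sum of two units is even;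
-- conversely every even residue is a sum of two units (choose the first summand among
-- 1 and p + 2 so that the second one avoids 0 modulo p), and hence every odd residue is a
-- sum of three.  So all distances are at most 3, and the difference (0, 1) needs 3 steps.
module Submission where

open import Defs
open import Data.Fin using (Fin; toℕ; fromℕ<)
open import Data.Fin.Properties using (toℕ<n; toℕ-fromℕ<; toℕ-injective)
open import Data.Nat
open import Data.Nat.Coprimality using (Coprime; coprime-divisor; 1-coprimeTo)
open import Data.Nat.Divisibility
open import Data.Nat.DivMod
open import Data.Nat.Primality using (Prime; prime[2]; prime⇒irreducible; prime⇒nonTrivial)
open import Data.Nat.Properties
open import Algebra.Properties.CommutativeSemigroup +-commutativeSemigroup using (x∙yz≈y∙xz; xy∙z≈y∙xz)
open import Data.Product using (Σ-syntax; _×_; _,_; proj₁; proj₂)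
open import Data.Sum using (inj₁; inj₂)
open import Function using (_∘_)
open import Data.Vec using (Vec; []; _∷_; sum)
open import Data.Vec.Relation.Unary.All using (All; []; _∷_)
open import Relation.Binary.PropositionalEquality
open import Relation.Nullary using (¬_; yes; no; contradiction)
open ≡-Reasoning

private
  variable
    c d k m n o q r s t : ℕ

coprime⇒coprime-% : .{{_ : NonZero n}} → Coprime m n → Coprime (m % n) n
coprime⇒coprime-% m⊥n (d∣m%n , d∣n) = m⊥n (∣n∣m%n⇒∣m d∣n d∣m%n , d∣n)

coprime∧∣⇒∤ : Coprime m n → d ∣ n → d ≢ 1 → d ∤ m
coprime∧∣⇒∤ m⊥n d∣n d≢1 d∣m = d≢1 (m⊥n (d∣m , d∣n))

∤⇒coprime : Prime q → q ∤ m → Coprime m q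
∤⇒coprime q-prime q∤m (d∣m , d∣q) with prime⇒irreducible q-prime d∣q
... | inj₁ d≡1 = d≡1
... | inj₂ refl = contradiction d∣m q∤m

coprime-* : Coprime m n → Coprime m o → Coprime m (n * o)
coprime-* {m} {n} m⊥n m⊥o {d} (d∣m , d∣no) = m⊥o (d∣m , coprime-divisor d⊥n d∣no)
  where
  d⊥n : Coprime d n
  d⊥n (e∣d , e∣n) = m⊥n (∣-trans e∣d d∣m , e∣n)

coprime-^ : ∀ k → Coprime m n → Coprime m (n ^ k)
coprime-^ zero    m⊥n (_ , d∣1) = ∣1⇒≡1 d∣1
coprime-^ (suc k) m⊥n = coprime-* m⊥n (coprime-^ k m⊥n)

%≢0⇒∤ : .{{_ : NonZero n}} → m % n ≢ 0 → n ∤ m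
%≢0⇒∤ {n = n} {m = m} m%n≢0 n∣m = m%n≢0 (n∣m⇒m%n≡0 m n n∣m)

[m%n+o]%n≡[m+o]%n : ∀ m o n .{{_ : NonZero n}} → (m % n + o) % n ≡ (m + o) % n
[m%n+o]%n≡[m+o]%n m o n = begin
  (m % n + o) % n          ≡⟨ %-distribˡ-+ (m % n) o n ⟩
  (m % n % n + o % n) % n  ≡⟨ cong (λ r → (r + o % n) % n) (m%n%n≡m%n m n) ⟩
  (m % n + o % n) % n      ≡⟨ %-distribˡ-+ m o n ⟨
  (m + o) % n              ∎

[m+o%n]%n≡[m+o]%n : ∀ m o n .{{_ : NonZero n}} → (m + o % n) % n ≡ (m + o) % n
[m+o%n]%n≡[m+o]%n m o n = begin
  (m + o % n) % n  ≡⟨ cong (_% n) (+-comm m (o % n)) ⟩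
  (o % n + m) % n  ≡⟨ [m%n+o]%n≡[m+o]%n o m n ⟩
  (o + m) % n      ≡⟨ cong (_% n) (+-comm o m) ⟩
  (m + o) % n      ∎

-- d + n ∸ c represents d - c modulo n.
%≢⇒∤-+∸ : .{{_ : NonZero q}} → c ≤ n → q ∣ n → c % q ≢ d % q → q ∤ d + n ∸ c
%≢⇒∤-+∸ {q} {c} {n} {d} c≤n q∣n c≢d q∣d+n∸c = c≢d (begin
  c % q                  ≡⟨ %-remove-+ʳ c q∣d+n∸c ⟨
  (c + (d + n ∸ c)) % q  ≡⟨ cong (_% q) (m+[n∸m]≡n (≤-trans c≤n (m≤n+m n d))) ⟩
  (d + n) % q            ≡⟨ %-remove-+ʳ d q∣n ⟩
  d % q                  ∎)

2∤⇒%2≡1 : 2 ∤ m → m % 2 ≡ 1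
2∤⇒%2≡1 {m} 2∤m with m % 2 in m%2 | m%n<n m 2
... | 0      | _               = contradiction (m%n≡0⇒n∣m m 2 m%2) 2∤m
... | 1      | _               = refl
... | 2+ _   | s≤s (s≤s ())

2∤1 : 2 ∤ 1
2∤1 2∣1 = contradiction (∣1⇒≡1 2∣1) λ ()

2∤∧2∤⇒2∣+ : 2 ∤ m → 2 ∤ n → 2 ∣ m + n
2∤∧2∤⇒2∣+ {m} {n} 2∤m 2∤n = m%n≡0⇒n∣m (m + n) 2 (begin
  (m + n) % 2          ≡⟨ %-distribˡ-+ m n 2 ⟩
  (m % 2 + n % 2) % 2  ≡⟨ cong₂ (λ a b → (a + b) % 2) (2∤⇒%2≡1 2∤m) (2∤⇒%2≡1 2∤n) ⟩
  0                    ∎)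

infixl 6 _⊕_

_⊕_ : ∀ {n} .{{_ : NonZero n}} → Fin n → ℕ → Fin n
_⊕_ {n} y s = fromℕ< (m%n<n (toℕ y + s) n)

module _ {n : ℕ} .{{_ : NonZero n}} where

  toℕ-⊕ : (y : Fin n) (s : ℕ) → toℕ (y ⊕ s) ≡ (toℕ y + s) % n
  toℕ-⊕ y s = toℕ-fromℕ< (m%n<n (toℕ y + s) n)

  toℕ+[n∸toℕ]≡n : (y : Fin n) → toℕ y + (n ∸ toℕ y) ≡ n
  toℕ+[n∸toℕ]≡n y = m+[n∸m]≡n (<⇒≤ (toℕ<n y))

  ⊕-cong : (y : Fin n) → s % n ≡ t % n → y ⊕ s ≡ y ⊕ t
  ⊕-cong {s} {t} y s≡t = toℕ-injective (begin
    toℕ (y ⊕ s)            ≡⟨ toℕ-⊕ y s ⟩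
    (toℕ y + s) % n        ≡⟨ [m+o%n]%n≡[m+o]%n (toℕ y) s n ⟨
    (toℕ y + s % n) % n    ≡⟨ cong (λ r → (toℕ y + r) % n) s≡t ⟩
    (toℕ y + t % n) % n    ≡⟨ [m+o%n]%n≡[m+o]%n (toℕ y) t n ⟩
    (toℕ y + t) % n        ≡⟨ toℕ-⊕ y t ⟨
    toℕ (y ⊕ t)            ∎)

  ⊕-identityʳ : (y : Fin n) → y ⊕ 0 ≡ y
  ⊕-identityʳ y = toℕ-injective (begin
    toℕ (y ⊕ 0)      ≡⟨ toℕ-⊕ y 0 ⟩
    (toℕ y + 0) % n  ≡⟨ cong (_% n) (+-identityʳ (toℕ y)) ⟩
    toℕ y % n        ≡⟨ m<n⇒m%n≡m (toℕ<n y) ⟩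
    toℕ y            ∎)

  ⊕-assoc : (y : Fin n) (s t : ℕ) → y ⊕ s ⊕ t ≡ y ⊕ (s + t)
  ⊕-assoc y s t = toℕ-injective (begin
    toℕ (y ⊕ s ⊕ t)            ≡⟨ toℕ-⊕ (y ⊕ s) t ⟩
    (toℕ (y ⊕ s) + t) % n      ≡⟨ cong (λ r → (r + t) % n) (toℕ-⊕ y s) ⟩
    ((toℕ y + s) % n + t) % n  ≡⟨ [m%n+o]%n≡[m+o]%n (toℕ y + s) t n ⟩
    (toℕ y + s + t) % n        ≡⟨ cong (_% n) (+-assoc (toℕ y) s t) ⟩
    (toℕ y + (s + t)) % n      ≡⟨ toℕ-⊕ y (s + t) ⟨
    toℕ (y ⊕ (s + t))          ∎)

  subMod-⊕ : (y : Fin n) (s : ℕ) → subMod n (y ⊕ s) y ≡ s % n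
  subMod-⊕ y s = begin
    (toℕ (y ⊕ s) + (n ∸ toℕ y)) % n      ≡⟨ cong (λ r → (r + (n ∸ toℕ y)) % n) (toℕ-⊕ y s) ⟩
    ((toℕ y + s) % n + (n ∸ toℕ y)) % n  ≡⟨ [m%n+o]%n≡[m+o]%n (toℕ y + s) (n ∸ toℕ y) n ⟩
    (toℕ y + s + (n ∸ toℕ y)) % n        ≡⟨ cong (_% n) (xy∙z≈y∙xz (toℕ y) s (n ∸ toℕ y)) ⟩
    (s + (toℕ y + (n ∸ toℕ y))) % n      ≡⟨ cong (λ r → (s + r) % n) (toℕ+[n∸toℕ]≡n y) ⟩
    (s + n) % n                          ≡⟨ [m+n]%n≡m%n s n ⟩
    s % n                                ∎

  ⊕-subMod : (x y : Fin n) → y ⊕ subMod n x y ≡ x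
  ⊕-subMod x y = toℕ-injective (begin
    toℕ (y ⊕ subMod n x y)                       ≡⟨ toℕ-⊕ y (subMod n x y) ⟩
    (toℕ y + (toℕ x + (n ∸ toℕ y)) % n) % n      ≡⟨ [m+o%n]%n≡[m+o]%n (toℕ y) _ n ⟩
    (toℕ y + (toℕ x + (n ∸ toℕ y))) % n          ≡⟨ cong (_% n) (x∙yz≈y∙xz (toℕ y) (toℕ x) _) ⟩
    (toℕ x + (toℕ y + (n ∸ toℕ y))) % n          ≡⟨ cong (λ r → (toℕ x + r) % n) (toℕ+[n∸toℕ]≡n y) ⟩
    (toℕ x + n) % n                              ≡⟨ [m+n]%n≡m%n (toℕ x) n ⟩
    toℕ x % n                                    ≡⟨ m<n⇒m%n≡m (toℕ<n x) ⟩
    toℕ x                                        ∎)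

  ⊕-cancelˡ : (y : Fin n) → y ⊕ s ≡ y ⊕ t → s % n ≡ t % n
  ⊕-cancelˡ {s} {t} y y⊕s≡y⊕t = begin
    s % n                ≡⟨ subMod-⊕ y s ⟨
    subMod n (y ⊕ s) y   ≡⟨ cong (λ x → subMod n x y) y⊕s≡y⊕t ⟩
    subMod n (y ⊕ t) y   ≡⟨ subMod-⊕ y t ⟩
    t % n                ∎

UnitSum : (n : ℕ) .{{_ : NonZero n}} → ℕ → ℕ → Set
UnitSum n k d = Σ[ ss ∈ Vec ℕ k ] All (inφ n) ss × sum ss % n ≡ d % n

module _ {n : ℕ} .{{_ : NonZero n}} where

  unitSum-refl : (x : Fin n) → UnitSum n 0 (subMod n x x)
  unitSum-refl x = [] , [] , sym (⊕-cancelˡ x (trans (⊕-subMod x x) (sym (⊕-identityʳ x))))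

  unitSum₀⇒≡ : (x y : Fin n) → UnitSum n 0 (subMod n x y) → x ≡ y
  unitSum₀⇒≡ x y ([] , [] , 0≡x-y) = begin
    x                   ≡⟨ ⊕-subMod x y ⟨
    y ⊕ subMod n x y    ≡⟨ ⊕-cong y (sym 0≡x-y) ⟩
    y ⊕ 0               ≡⟨ ⊕-identityʳ y ⟩
    y                   ∎

  unitSum-cons : (x z y : Fin n) → inφ n (subMod n x z) → UnitSum n k (subMod n z y) →
                 UnitSum n (suc k) (subMod n x y)
  unitSum-cons x z y x-z-unit (ss , units , Σss≡z-y) =
    subMod n x z ∷ ss , x-z-unit ∷ units , (begin
      (subMod n x z + sum ss) % n  ≡⟨ cong (_% n) (+-comm (subMod n x z) (sum ss)) ⟩
      (sum ss + subMod n x z) % n  ≡⟨ ⊕-cancelˡ y y⊕Σss+[x-z]≡y⊕[x-y] ⟩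
      subMod n x y % n             ∎)
    where
    y⊕Σss+[x-z]≡y⊕[x-y] : y ⊕ (sum ss + subMod n x z) ≡ y ⊕ subMod n x y
    y⊕Σss+[x-z]≡y⊕[x-y] = begin
      y ⊕ (sum ss + subMod n x z)     ≡⟨ ⊕-assoc y (sum ss) (subMod n x z) ⟨
      y ⊕ sum ss ⊕ subMod n x z       ≡⟨ cong (_⊕ subMod n x z) (⊕-cong y Σss≡z-y) ⟩
      y ⊕ subMod n z y ⊕ subMod n x z ≡⟨ cong (_⊕ subMod n x z) (⊕-subMod z y) ⟩
      z ⊕ subMod n x z                ≡⟨ ⊕-subMod x z ⟩
      x                               ≡⟨ ⊕-subMod x y ⟨
      y ⊕ subMod n x y                ∎

  unitSum-uncons : (x y : Fin n) → UnitSum n (suc k) (subMod n x y) →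
                   Σ[ z ∈ Fin n ] inφ n (subMod n x z) × UnitSum n k (subMod n z y)
  unitSum-uncons x y (s ∷ ss , s-unit ∷ units , s+Σss≡x-y) =
    z , subst (inφ n) (sym x-z≡s) (coprime⇒coprime-% s-unit) ,
    ss , units , sym (trans (cong (_% n) (subMod-⊕ y (sum ss))) (m%n%n≡m%n (sum ss) n))
    where
    z : Fin n
    z = y ⊕ sum ss
    x≡z⊕s : x ≡ z ⊕ s
    x≡z⊕s = begin
      x                   ≡⟨ ⊕-subMod x y ⟨
      y ⊕ subMod n x y    ≡⟨ ⊕-cong y (trans (sym s+Σss≡x-y) (cong (_% n) (+-comm s (sum ss)))) ⟩
      y ⊕ (sum ss + s)    ≡⟨ ⊕-assoc y (sum ss) s ⟨
      z ⊕ s               ∎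
    x-z≡s : subMod n x z ≡ s % n
    x-z≡s = trans (cong (λ x → subMod n x z) x≡z⊕s) (subMod-⊕ z s)

  unitSum-⊕ : (y : Fin n) → UnitSum n k (subMod n (y ⊕ s) y) → UnitSum n k s
  unitSum-⊕ {s = s} y (ss , units , Σss≡y⊕s-y) =
    ss , units , trans Σss≡y⊕s-y (trans (cong (_% n) (subMod-⊕ y s)) (m%n%n≡m%n s n))

  unitSum-suc : UnitSum n k (d + (n ∸ 1)) → UnitSum n (suc k) d
  unitSum-suc {d = d} (ss , units , Σss≡d+n-1) = 1 ∷ ss , 1-coprimeTo n ∷ units , (begin
    (1 + sum ss) % n             ≡⟨ [m+o%n]%n≡[m+o]%n 1 (sum ss) n ⟨
    (1 + sum ss % n) % n         ≡⟨ cong (λ r → (1 + r) % n) Σss≡d+n-1 ⟩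
    (1 + (d + (n ∸ 1)) % n) % n  ≡⟨ [m+o%n]%n≡[m+o]%n 1 (d + (n ∸ 1)) n ⟩
    (1 + (d + (n ∸ 1))) % n      ≡⟨ cong (_% n) (x∙yz≈y∙xz 1 d (n ∸ 1)) ⟩
    (d + (1 + (n ∸ 1))) % n      ≡⟨ cong (λ r → (d + r) % n) (m+[n∸m]≡n (>-nonZero⁻¹ n)) ⟩
    (d + n) % n                  ≡⟨ [m+n]%n≡m%n d n ⟩
    d % n                        ∎)

  unitSum-pair : c ≤ n → inφ n c → inφ n (d + n ∸ c) → UnitSum n 2 d
  unitSum-pair {c} {d} c≤n c-unit d-c-unit =
    c ∷ d + n ∸ c ∷ [] , c-unit ∷ d-c-unit ∷ [] , (begin
      (c + (d + n ∸ c + 0)) % n  ≡⟨ cong (λ r → (c + r) % n) (+-identityʳ (d + n ∸ c)) ⟩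
      (c + (d + n ∸ c)) % n      ≡⟨ cong (_% n) (m+[n∸m]≡n (≤-trans c≤n (m≤n+m n d))) ⟩
      (d + n) % n                ≡⟨ [m+n]%n≡m%n d n ⟩
      d % n                      ∎)

  ¬unitSum₀-1 : 1 < n → ¬ UnitSum n 0 1
  ¬unitSum₀-1 1<n ([] , [] , 0%n≡1%n) =
    contradiction (begin
      0      ≡⟨ m<n⇒m%n≡m (>-nonZero⁻¹ n) ⟨
      0 % n  ≡⟨ 0%n≡1%n ⟩
      1 % n  ≡⟨ m<n⇒m%n≡m 1<n ⟩
      1      ∎) λ ()

  ¬unitSum₁-0 : 1 < n → ¬ UnitSum n 1 0
  ¬unitSum₁-0 1<n (s ∷ [] , s-unit ∷ [] , s+0≡0) =
    coprime∧∣⇒∤ s-unit ∣-refl (>⇒≢ 1<n) (subst (n ∣_) (+-identityʳ s) n∣s+0)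
    where
    n∣s+0 : n ∣ s + 0
    n∣s+0 = m%n≡0⇒n∣m (s + 0) n (trans s+0≡0 (m<n⇒m%n≡m (>-nonZero⁻¹ n)))

  -- Modulo an even number every unit is odd.
  ¬unitSum₂-odd : 2 ∣ n → 2 ∤ d → ¬ UnitSum n 2 d
  ¬unitSum₂-odd {d} 2∣n 2∤d (s ∷ t ∷ [] , s-unit ∷ t-unit ∷ [] , s+t≡d) =
    2∤d (m%n≡0⇒n∣m d 2 (begin
      d % 2                  ≡⟨ m∣n⇒o%n%m≡o%m 2 n d 2∣n ⟨
      d % n % 2              ≡⟨ cong (_% 2) s+t≡d ⟨
      (s + (t + 0)) % n % 2  ≡⟨ m∣n⇒o%n%m≡o%m 2 n (s + (t + 0)) 2∣n ⟩
      (s + (t + 0)) % 2      ≡⟨ n∣m⇒m%n≡0 _ 2 (2∤∧2∤⇒2∣+ (odd s-unit) (odd t+0-unit)) ⟩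
      0                      ∎))
    where
    odd : inφ n o → 2 ∤ o
    odd o-unit = coprime∧∣⇒∤ o-unit 2∣n λ ()
    t+0-unit : inφ n (t + 0)
    t+0-unit = subst (inφ n) (sym (+-identityʳ t)) t-unit

module _ {p m : ℕ} .{{_ : NonZero p}} .{{_ : NonZero m}} where

  unitSums⇒walk : ∀ k (x y : Fin p × Fin m) →
                  UnitSum p k (subMod p (proj₁ x) (proj₁ y)) →
                  UnitSum m k (subMod m (proj₂ x) (proj₂ y)) →
                  Walk (Adj p m) x y k
  unitSums⇒walk zero (x₁ , x₂) (y₁ , y₂) u v =
    subst (λ x → Walk (Adj p m) x (y₁ , y₂) 0)
          (sym (cong₂ _,_ (unitSum₀⇒≡ x₁ y₁ u) (unitSum₀⇒≡ x₂ y₂ v))) here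
  unitSums⇒walk (suc k) (x₁ , x₂) y u v
    with unitSum-uncons x₁ (proj₁ y) u | unitSum-uncons x₂ (proj₂ y) v
  ... | z₁ , a₁ , u′ | z₂ , a₂ , v′ = step (a₁ , a₂) (unitSums⇒walk k (z₁ , z₂) y u′ v′)

  walk⇒unitSums : {x y : Fin p × Fin m} → Walk (Adj p m) x y k →
                  UnitSum p k (subMod p (proj₁ x) (proj₁ y)) ×
                  UnitSum m k (subMod m (proj₂ x) (proj₂ y))
  walk⇒unitSums {x = x₁ , x₂} here = unitSum-refl x₁ , unitSum-refl x₂
  walk⇒unitSums {x = x₁ , x₂} {y₁ , y₂} (step {y = z₁ , z₂} (a₁ , a₂) w) =
    let u , v = walk⇒unitSums w in
    unitSum-cons x₁ z₁ y₁ a₁ u , unitSum-cons x₂ z₂ y₂ a₂ v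

module _ {p : ℕ} .{{_ : NonZero p}} (p-prime : Prime p) (p≢2 : p ≢ 2) where

  1<p : 1 < p
  1<p = nonTrivial⇒n>1 p {{prime⇒nonTrivial p-prime}}

  2<p : 2 < p
  2<p = ≤∧≢⇒< 1<p (p≢2 ∘ sym)

  2∤p : 2 ∤ p
  2∤p 2∣p with prime⇒irreducible p-prime 2∣p
  ... | inj₁ ()
  ... | inj₂ 2≡p = p≢2 (sym 2≡p)

  1%p≡1 : 1 % p ≡ 1
  1%p≡1 = m<n⇒m%n≡m 1<p

  unitSum₂-prime-via : c ≤ p → c % p ≡ r → r ≢ 0 → r ≢ d % p → UnitSum p 2 d
  unitSum₂-prime-via c≤p c%p≡r r≢0 r≢d = unitSum-pair c≤p
    (∤⇒coprime p-prime (%≢0⇒∤ (r≢0 ∘ trans (sym c%p≡r))))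
    (∤⇒coprime p-prime (%≢⇒∤-+∸ c≤p ∣-refl (r≢d ∘ trans (sym c%p≡r))))

  unitSum₂-prime : ∀ d → UnitSum p 2 d
  unitSum₂-prime d with d % p ≟ 1
  ... | no d%p≢1  = unitSum₂-prime-via (<⇒≤ 1<p) 1%p≡1 (λ ()) (d%p≢1 ∘ sym)
  ... | yes d%p≡1 = unitSum₂-prime-via (<⇒≤ 2<p) (m<n⇒m%n≡m 2<p) (λ ())
    (λ 2≡d → contradiction (trans 2≡d d%p≡1) λ ())

  unitSum₃-prime : ∀ d → UnitSum p 3 d
  unitSum₃-prime d = unitSum-suc (unitSum₂-prime (d + (p ∸ 1)))

  -- unit says that 2 and p are the only prime divisors of m.
  module _ {m : ℕ} .{{_ : NonZero m}} (2p∣m : 2 * p ∣ m)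
           (unit : ∀ {c} → 2 ∤ c → p ∤ c → inφ m c) where

    2∣m : 2 ∣ m
    2∣m = m*n∣⇒m∣ 2 p 2p∣m

    p∣m : p ∣ m
    p∣m = m*n∣⇒n∣ 2 p 2p∣m

    unitSum₂-even-via : c ≤ m → c % 2 ≡ 1 → c % p ≡ r → r ≢ 0 → r ≢ d % p → 2 ∣ d →
                        UnitSum m 2 d
    unitSum₂-even-via {c} {r} {d} c≤m c%2≡1 c%p≡r r≢0 r≢d 2∣d =
      unitSum-pair c≤m (unit 2∤c (%≢0⇒∤ c%p≢0))
        (unit (%≢⇒∤-+∸ c≤m 2∣m c%2≢d%2) (%≢⇒∤-+∸ c≤m p∣m (r≢d ∘ trans (sym c%p≡r))))
      where
      c%p≢0 : c % p ≢ 0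
      c%p≢0 = r≢0 ∘ trans (sym c%p≡r)
      c%2≢d%2 : c % 2 ≢ d % 2
      c%2≢d%2 c≡d = contradiction (trans (sym c%2≡1) (trans c≡d (n∣m⇒m%n≡0 d 2 2∣d))) λ ()
      2∤c : 2 ∤ c
      2∤c = %≢0⇒∤ λ c%2≡0 → contradiction (trans (sym c%2≡1) c%2≡0) λ ()

    unitSum₂-even : 2 ∣ d → UnitSum m 2 d
    unitSum₂-even {d} with d % p ≟ 1
    ... | no d%p≢1  = unitSum₂-even-via (>-nonZero⁻¹ m) refl 1%p≡1 (λ ()) (d%p≢1 ∘ sym)
    ... | yes d%p≡1 = unitSum₂-even-via 2+p≤m [2+p]%2≡1 [2+p]%p≡2 (λ ())
      (λ 2≡d → contradiction (trans 2≡d d%p≡1) λ ())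
      where
      [2+p]%2≡1 : (2 + p) % 2 ≡ 1
      [2+p]%2≡1 = trans (%-remove-+ˡ p ∣-refl) (2∤⇒%2≡1 2∤p)
      [2+p]%p≡2 : (2 + p) % p ≡ 2
      [2+p]%p≡2 = trans ([m+n]%n≡m%n 2 p) (m<n⇒m%n≡m 2<p)
      2+p≤m : 2 + p ≤ m
      2+p≤m = ≤-trans (+-monoˡ-≤ p (<⇒≤ 2<p))
                (subst (_≤ m) (cong (p +_) (+-identityʳ p)) (∣⇒≤ 2p∣m))

    unitSum₃-odd : 2 ∤ d → UnitSum m 3 d
    unitSum₃-odd {d} 2∤d = unitSum-suc (unitSum₂-even (2∤∧2∤⇒2∣+ 2∤d 2∤m∸1))
      where
      2∤m∸1 : 2 ∤ m ∸ 1
      2∤m∸1 2∣m∸1 = 2∤1 (∣m+n∣m⇒∣n (subst (2 ∣_) (sym (m∸n+n≡m (>-nonZero⁻¹ m))) 2∣m) 2∣m∸1)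

    cayley-diameter₃ : HasDiameter (Fin p × Fin m) (Adj p m) 3
    cayley-diameter₃ = within-3 , x₀ , y₀ , no-shorter-walk
      where
      within-3 : (x y : Fin p × Fin m) → DistLe (Adj p m) x y 3
      within-3 x y with 2 ∣? subMod m (proj₂ x) (proj₂ y)
      ... | yes even = 2 , s≤s (s≤s z≤n) ,
                       unitSums⇒walk 2 x y (unitSum₂-prime _) (unitSum₂-even even)
      ... | no odd   = 3 , ≤-refl , unitSums⇒walk 3 x y (unitSum₃-prime _) (unitSum₃-odd odd)

      y₀ x₀ : Fin p × Fin m
      y₀ = fromℕ< (>-nonZero⁻¹ p) , fromℕ< (>-nonZero⁻¹ m)
      x₀ = proj₁ y₀ ⊕ 0 , proj₂ y₀ ⊕ 1

      walk-x₀-y₀⇒unitSums : Walk (Adj p m) x₀ y₀ k → UnitSum p k 0 × UnitSum m k 1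
      walk-x₀-y₀⇒unitSums w =
        let u , v = walk⇒unitSums w in unitSum-⊕ (proj₁ y₀) u , unitSum-⊕ (proj₂ y₀) v

      no-shorter-walk : ∀ k → k < 3 → ¬ Walk (Adj p m) x₀ y₀ k
      no-shorter-walk 0 _ w = ¬unitSum₀-1 (≤-trans 1<p (∣⇒≤ p∣m)) (proj₂ (walk-x₀-y₀⇒unitSums w))
      no-shorter-walk 1 _ w = ¬unitSum₁-0 1<p (proj₁ (walk-x₀-y₀⇒unitSums w))
      no-shorter-walk 2 _ w = ¬unitSum₂-odd 2∣m 2∤1 (proj₂ (walk-x₀-y₀⇒unitSums w))
      no-shorter-walk (suc (suc (suc _))) (s≤s (s≤s (s≤s ()))) _

proposition3p3 : (p α β : ℕ) → Prime p → p ≢ 2 → 1 ≤ α → 1 ≤ β →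
    .{{_ : NonZero p}} → .{{_ : NonZero (2 ^ α * p ^ β)}} →
    HasDiameter (Fin p × Fin (2 ^ α * p ^ β)) (Adj p (2 ^ α * p ^ β)) 3
proposition3p3 p (suc α) (suc β) p-prime p≢2 _ _ =
  cayley-diameter₃ p-prime p≢2 (*-pres-∣ (m∣m*n {2} (2 ^ α)) (m∣m*n {p} (p ^ β))) λ 2∤c p∤c →
    coprime-* (coprime-^ (suc α) (∤⇒coprime prime[2] 2∤c))
              (coprime-^ (suc β) (∤⇒coprime p-prime p∤c))
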